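{- Let $E$ be a $3$-tangle shadow (the generator of Ashley's figure-eight chain) whose bracket is $\langle E\rangle=(x^2+4x+4)\langle 1_3\rangle+(x+2)\langle U_1\rangle+(x+2)\langle U_2\rangle+\langle s\rangle$, and let $E_n=EE\cdots E$ ($n$ factors, $E_0=1_3$). Then for all $n\ge0$ \[\langle\overline{E_n}\rangle=x(x^2-2)(x^2+4x+4)^n+x\left(\left(\tfrac{4x^2+12x+9-\sqrt{8x^2+24x+17}}{2}\right)^n+\left(\tfrac{4x^2+12x+9+\sqrt{8x^2+24x+17}}{2}\right)^n\right),\] and \[\sum_{n\ge0}\langle\overline{E_n}\rangle y^n=\frac{x\big((-4x^2-12x-9)y+2\big)}{(4x^4+24x^3+52x^2+48x+16)y^2+(-4x^2-12x-9)y+1}+\frac{x(x^2-2)}{1-(x^2+4x+4)y}.\]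
   Context: A $3$-tangle shadow is a tangle diagram in a rectangle with three endpoints on the top edge and three on the bottom edge, whose crossings are flat (no over/under information); it may contain closed components. The product $XY$ is concatenation (stacking in a fixed order). The closure $\overline{X}$ joins the $i$-th top endpoint to the $i$-th bottom endpoint ($i=1,2,3$) by parallel arcs without new crossings. A state of a shadow is a choice at each crossing of one of the two smoothings; for a link shadow $K$, $\langle K\rangle=\sum_S x^{|S|}\in\mathbb{Z}[x]$, $|S|$ the number of loops of $S$. Crossingless $3$-tangles modulo closed loops form $\mathcal{D}_3=\{1_3,U_1,U_2,r,s\}$: $1_3$ is three vertical strands; $U_1$ consists of an arc joining top endpoints $1,2$, an arc joining bottom endpoints $1,2$, and a vertical strand at position $3$; $U_2$ is the same with positions $2,3$; $r:=U_1U_2$, $s:=U_2U_1$. Every state of a $3$-tangle shadow $B$ is $\bigcirc^k\sqcup U$ with $k$ loops and $U\in\mathcal{D}_3$, and $\langle B\rangle=\sum_S x^k\langle U\rangle$, a formal $\mathbb{Z}[x]$-linear combination of $\langle 1_3\rangle,\langle U_1\rangle,\langle U_2\rangle,\langle r\rangle,\langle s\rangle$. The generating function is a formal power series in $y$. -}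

module Defs where

open import Data.Nat as ℕ using (ℕ; zero; suc; _∸_; _≡ᵇ_)
open import Data.Bool using (Bool; true; false; _∧_; if_then_else_)
open import Data.Vec as Vec using (Vec; []; _∷_)
open import Data.List as List using (List; []; _∷_; map; _++_; upTo; foldr)
open import Data.Product using (_×_; _,_; proj₁; proj₂)
open import Algebra.Bundles using (CommutativeRing)

-- Crossingless 3-tangles modulo closed loops: D₃ = {1₃, U₁, U₂, r, s}
-- with r = U₁U₂ and s = U₂U₁.

data D3 : Set where
  one U₁ U₂ r s : D3

-- Concatenation of crossingless tangles: (number of closed loops
-- created, resulting element of D₃).  This is the Temperley–Lieb
-- multiplication table (U_i U_i = loop ⊔ U_i, U₁U₂U₁ = U₁, U₂U₁U₂ = U₂).
_·_ : D3 → D3 → ℕ × D3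
one · a   = 0 , a
U₁  · one = 0 , U₁
U₁  · U₁  = 1 , U₁
U₁  · U₂  = 0 , r
U₁  · r   = 1 , r
U₁  · s   = 0 , U₁
U₂  · one = 0 , U₂
U₂  · U₁  = 0 , s
U₂  · U₂  = 1 , U₂
U₂  · r   = 0 , U₂
U₂  · s   = 1 , s
r   · one = 0 , r
r   · U₁  = 0 , U₁
r   · U₂  = 1 , r
r   · r   = 0 , r
r   · s   = 1 , U₁
s   · one = 0 , s
s   · U₁  = 1 , s
s   · U₂  = 0 , U₂
s   · r   = 1 , U₂
s   · s   = 0 , s

closureLoops : D3 → ℕ
closureLoops one = 3
closureLoops U₁  = 2
closureLoops U₂  = 2
closureLoops r   = 1
closureLoops s   = 1

eqD3 : D3 → D3 → Bool
eqD3 one one = true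
eqD3 U₁ U₁ = true
eqD3 U₂ U₂ = true
eqD3 r r = true
eqD3 s s = true
eqD3 _ _ = false

-- A 3-tangle shadow, recorded through its state structure: a number of
-- (flat) crossings, and for each state (a choice of smoothing at every
-- crossing) the resolution ◯^k ⊔ U, given as (k , U).

record Shadow : Set where
  field
    crossings : ℕ
    resolve   : Vec Bool crossings → ℕ × D3
open Shadow public

allStates : (n : ℕ) → List (Vec Bool n)
allStates zero    = [] ∷ []
allStates (suc n) = map (true ∷_) (allStates n) ++ map (false ∷_) (allStates n)

-- Product XY (stacking): a state of XY is a state of X together with a
-- state of Y; loops add up, plus the loops created when composing.
_⊗_ : Shadow → Shadow → Shadow
crossings (X ⊗ Y) = crossings X ℕ.+ crossings Y
resolve   (X ⊗ Y) v =
  let kx = proj₁ (resolve X (Vec.take (crossings X) v))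
      a  = proj₂ (resolve X (Vec.take (crossings X) v))
      ky = proj₁ (resolve Y (Vec.drop (crossings X) v))
      b  = proj₂ (resolve Y (Vec.drop (crossings X) v))
  in (kx ℕ.+ ky ℕ.+ proj₁ (a · b)) , proj₂ (a · b)

id₃ : Shadow
crossings id₃ = 0
resolve   id₃ _ = 0 , one

_^^_ : Shadow → ℕ → Shadow
E ^^ zero  = id₃
E ^^ suc n = E ⊗ (E ^^ n)

-- Coefficient of x^k ⟨U⟩ in the formal bracket ⟨X⟩ = Σ_S x^k ⟨U⟩:
-- the number of states of X resolving to ◯^k ⊔ U.
bracketCoeff : Shadow → ℕ → D3 → ℕ
bracketCoeff X k U =
  foldr ℕ._+_ 0
    (map (λ v → if (proj₁ (resolve X v) ≡ᵇ k) ∧ eqD3 (proj₂ (resolve X v)) U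
                then 1 else 0)
         (allStates (crossings X)))

-- Coefficients of the given bracket
-- ⟨E⟩ = (x²+4x+4)⟨1₃⟩ + (x+2)⟨U₁⟩ + (x+2)⟨U₂⟩ + ⟨s⟩.
coeffE : ℕ → D3 → ℕ
coeffE 0 one = 4
coeffE 1 one = 4
coeffE 2 one = 1
coeffE 0 U₁  = 2
coeffE 1 U₁  = 1
coeffE 0 U₂  = 2
coeffE 1 U₂  = 1
coeffE 0 s   = 1
coeffE _ _   = 0

module RingDefs {c ℓ} (R : CommutativeRing c ℓ) where
  open CommutativeRing R

  nat : ℕ → Carrier
  nat zero    = 0#
  nat (suc n) = 1# + nat n

  pow : Carrier → ℕ → Carrier
  pow a zero    = 1#
  pow a (suc n) = a * pow a n

  sumL : List Carrier → Carrier
  sumL = foldr _+_ 0#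

  -- ⟨ closure of X ⟩ evaluated at x : Σ_S x^{|S|}, where a state
  -- resolving to ◯^k ⊔ U closes up to k + (loops of closure of U) loops.
  bracketClosure : Carrier → Shadow → Carrier
  bracketClosure x X =
    sumL (map (λ v → pow x (proj₁ (resolve X v) ℕ.+ closureLoops (proj₂ (resolve X v))))
              (allStates (crossings X)))

  Series : Set c
  Series = ℕ → Carrier

  -- polynomial in y given by its coefficient list (constant term first)
  poly : List Carrier → Series
  poly []       n       = 0#
  poly (a ∷ as) zero    = a
  poly (a ∷ as) (suc n) = poly as n

  _⊕_ : Series → Series → Series
  (f ⊕ g) n = f n + g n

  _⋆_ : Series → Series → Series
  (f ⋆ g) n = sumL (map (λ i → f i * g (n ∸ i)) (upTo (suc n)))

module Submission where

open import Defs
open import Data.Nat using (ℕ)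
open import Data.List using (List; []; _∷_)
open import Data.Product using (_×_)
open import Relation.Binary.PropositionalEquality using (_≡_)
open import Algebra.Bundles using (CommutativeRing)

open import Data.Bool using (Bool; true; false; T; _∧_; if_then_else_)
open import Data.Integer as ℤ using (ℤ; +_; -[1+_]; sign; ∣_∣; _◃_)
import Data.Integer.Properties as ℤP
open import Data.List using (map; _++_; foldr; upTo; applyUpTo; length)
import Data.List.Properties as LP
open import Data.List.Relation.Unary.All using (All; []; _∷_)
open import Data.Maybe using (Maybe; just; nothing)
open import Data.Nat as ℕ using (zero; suc; _≡ᵇ_; _∸_)
import Data.Nat.Properties as ℕP
open import Data.Product using (_,_; proj₁; proj₂)
open import Data.Sign as Sign using (Sign)
open import Data.Vec as Vec using (Vec; []; _∷_)
open import Function using (_∘_)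
import Relation.Binary.PropositionalEquality as P
open import Relation.Nullary using (yes; no)

-- The closures of Eₙ = E E ⋯ E are evaluated by a transfer-matrix argument.
-- A state sum over a shadow X is taken against a test function φ : D₃ → R: a
-- state resolving to ◯ᵏ ⊔ U contributes xᵏ φ(U), and ⟨closure of X⟩ is the state
-- sum against φ(U) = x^(number of loops of the closure of U).  Stacking E on top
-- of Y turns a state sum over E Y into one over Y against (transfer φ), where the
-- transfer operator only depends on the bracket of E; hence
-- ⟨closure of Eₙ⟩ = transferⁿ φ (1₃).  The closure test function splits as
-- A₀ δ + x ρ, where δ is an eigenfunction with eigenvalue Λ = (x+2)² and ρ spans
-- with transfer ρ a plane on which transfer satisfies z² = τ z - ν.  Therefore
-- ⟨closure of Eₙ⟩ = A₀ Λⁿ + x Lₙ, with L the Lucas sequence of z² - τ z + ν.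
-- Binet's formula for L gives the closed form, and a general lemma on a rational
-- generating function, Q₁ Q₂ F = N₁ Q₂ + N₂ Q₁, gives the second statement.

module IntegerSolver {c ℓ} (R : CommutativeRing c ℓ) where
  open CommutativeRing R
  open RingDefs R
  open import Algebra.Properties.Ring ring
    using (-0#≈0#; -‿+-comm; -1*x≈-x; -‿involutive; -‿distribʳ-*)
  open import Relation.Binary.Reasoning.Setoid setoid
  import Algebra.Solver.Ring.AlmostCommutativeRing as ACR

  nat-+ : ∀ m n → nat (m ℕ.+ n) ≈ nat m + nat n
  nat-+ zero    n = sym (+-identityˡ _)
  nat-+ (suc m) n = trans (+-congˡ (nat-+ m n)) (sym (+-assoc _ _ _))

  nat-* : ∀ m n → nat (m ℕ.* n) ≈ nat m * nat n
  nat-* zero    n = sym (zeroˡ _)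
  nat-* (suc m) n = begin
    nat (n ℕ.+ m ℕ.* n)          ≈⟨ nat-+ n (m ℕ.* n) ⟩
    nat n + nat (m ℕ.* n)        ≈⟨ +-congˡ (nat-* m n) ⟩
    nat n + nat m * nat n        ≈⟨ +-congʳ (*-identityˡ _) ⟨
    1# * nat n + nat m * nat n   ≈⟨ distribʳ _ _ _ ⟨
    (1# + nat m) * nat n         ∎

  ⟦_⟧ℤ : ℤ → Carrier
  ⟦ + n      ⟧ℤ = nat n
  ⟦ -[1+ n ] ⟧ℤ = - nat (suc n)

  ⊖-homo : ∀ m n → ⟦ m ℤ.⊖ n ⟧ℤ ≈ nat m - nat n
  ⊖-homo m       zero    = begin
    ⟦ m ℤ.⊖ 0 ⟧ℤ  ≡⟨ P.cong ⟦_⟧ℤ (ℤP.⊖-≥ {m} {0} ℕ.z≤n) ⟩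
    nat m         ≈⟨ +-identityʳ _ ⟨
    nat m + 0#    ≈⟨ +-congˡ -0#≈0# ⟨
    nat m - 0#    ∎
  ⊖-homo zero    (suc n) = sym (+-identityˡ _)
  ⊖-homo (suc m) (suc n) = begin
    ⟦ suc m ℤ.⊖ suc n ⟧ℤ         ≡⟨ P.cong ⟦_⟧ℤ (ℤP.[1+m]⊖[1+n]≡m⊖n m n) ⟩
    ⟦ m ℤ.⊖ n ⟧ℤ                 ≈⟨ ⊖-homo m n ⟩
    nat m - nat n                ≈⟨ cancel 1# (nat m) (nat n) ⟨
    (1# + nat m) - (1# + nat n)  ∎
    where
    cancel : ∀ a b d → (a + b) - (a + d) ≈ b - d
    cancel a b d = begin
      (a + b) - (a + d)        ≈⟨ +-congˡ (-‿+-comm a d) ⟨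
      (a + b) + (- a + - d)    ≈⟨ +-cong (+-comm a b) (+-comm (- a) (- d)) ⟩
      (b + a) + (- d + - a)    ≈⟨ +-assoc _ _ _ ⟩
      b + (a + (- d + - a))    ≈⟨ +-congˡ (+-congˡ (+-comm (- d) (- a))) ⟩
      b + (a + (- a + - d))    ≈⟨ +-congˡ (+-assoc _ _ _) ⟨
      b + ((a - a) + - d)      ≈⟨ +-congˡ (+-congʳ (-‿inverseʳ a)) ⟩
      b + (0# + - d)           ≈⟨ +-congˡ (+-identityˡ _) ⟩
      b - d                    ∎

  +-homo : ∀ i j → ⟦ i ℤ.+ j ⟧ℤ ≈ ⟦ i ⟧ℤ + ⟦ j ⟧ℤ
  +-homo (+ m)    (+ n)    = nat-+ m n
  +-homo (+ m)    -[1+ n ] = ⊖-homo m (suc n)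
  +-homo -[1+ m ] (+ n)    = trans (⊖-homo n (suc m)) (+-comm _ _)
  +-homo -[1+ m ] -[1+ n ] = begin
    - nat (suc (suc (m ℕ.+ n)))      ≡⟨ P.cong (λ k → - nat (suc k)) (P.sym (ℕP.+-suc m n)) ⟩
    - nat (suc m ℕ.+ suc n)          ≈⟨ -‿cong (nat-+ (suc m) (suc n)) ⟩
    - (nat (suc m) + nat (suc n))    ≈⟨ -‿+-comm _ _ ⟨
    - nat (suc m) + - nat (suc n)    ∎

  -‿homo : ∀ i → ⟦ ℤ.- i ⟧ℤ ≈ - ⟦ i ⟧ℤ
  -‿homo (+ zero)  = sym -0#≈0#
  -‿homo (+ suc n) = refl
  -‿homo -[1+ n ]  = sym (-‿involutive _)

  -- Multiplication is handled through the sign/absolute-value decomposition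
  -- i = sign i ◃ ∣ i ∣ used to define ℤ._*_.
  ⟦_⟧sign : Sign → Carrier
  ⟦ Sign.+ ⟧sign = 1#
  ⟦ Sign.- ⟧sign = - 1#

  ◃-homo : ∀ σ n → ⟦ σ ◃ n ⟧ℤ ≈ ⟦ σ ⟧sign * nat n
  ◃-homo σ      zero    = sym (zeroʳ _)
  ◃-homo Sign.+ (suc n) = sym (*-identityˡ _)
  ◃-homo Sign.- (suc n) = sym (-1*x≈-x _)

  sign-abs : ∀ i → ⟦ i ⟧ℤ ≈ ⟦ sign i ⟧sign * nat ∣ i ∣
  sign-abs (+ n)    = sym (*-identityˡ _)
  sign-abs -[1+ n ] = sym (-1*x≈-x _)

  sign-homo : ∀ σ τ → ⟦ σ Sign.* τ ⟧sign ≈ ⟦ σ ⟧sign * ⟦ τ ⟧sign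
  sign-homo Sign.+ τ      = sym (*-identityˡ _)
  sign-homo Sign.- Sign.+ = sym (*-identityʳ _)
  sign-homo Sign.- Sign.- = begin
    1#              ≈⟨ -‿involutive 1# ⟨
    - - 1#          ≈⟨ -‿cong (-1*x≈-x 1#) ⟨
    - (- 1# * 1#)   ≈⟨ -‿distribʳ-* _ _ ⟩
    - 1# * - 1#     ∎

  *-interchange : ∀ a b d e → (a * b) * (d * e) ≈ (a * d) * (b * e)
  *-interchange a b d e = begin
    (a * b) * (d * e)   ≈⟨ *-assoc _ _ _ ⟩
    a * (b * (d * e))   ≈⟨ *-congˡ (*-assoc _ _ _) ⟨
    a * ((b * d) * e)   ≈⟨ *-congˡ (*-congʳ (*-comm b d)) ⟩
    a * ((d * b) * e)   ≈⟨ *-congˡ (*-assoc _ _ _) ⟩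
    a * (d * (b * e))   ≈⟨ *-assoc _ _ _ ⟨
    (a * d) * (b * e)   ∎

  *-homo : ∀ i j → ⟦ i ℤ.* j ⟧ℤ ≈ ⟦ i ⟧ℤ * ⟦ j ⟧ℤ
  *-homo i j = begin
    ⟦ (sign i Sign.* sign j) ◃ (∣ i ∣ ℕ.* ∣ j ∣) ⟧ℤ
      ≈⟨ ◃-homo (sign i Sign.* sign j) (∣ i ∣ ℕ.* ∣ j ∣) ⟩
    ⟦ sign i Sign.* sign j ⟧sign * nat (∣ i ∣ ℕ.* ∣ j ∣)
      ≈⟨ *-cong (sign-homo (sign i) (sign j)) (nat-* ∣ i ∣ ∣ j ∣) ⟩
    (⟦ sign i ⟧sign * ⟦ sign j ⟧sign) * (nat ∣ i ∣ * nat ∣ j ∣)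
      ≈⟨ *-interchange _ _ _ _ ⟩
    (⟦ sign i ⟧sign * nat ∣ i ∣) * (⟦ sign j ⟧sign * nat ∣ j ∣)
      ≈⟨ *-cong (sign-abs i) (sign-abs j) ⟨
    ⟦ i ⟧ℤ * ⟦ j ⟧ℤ ∎

  ℤ⟶R : ℤ.+-*-rawRing ACR.-Raw-AlmostCommutative⟶ ACR.fromCommutativeRing R
  ℤ⟶R = record
    { ⟦_⟧ = ⟦_⟧ℤ ; +-homo = +-homo ; *-homo = *-homo ; -‿homo = -‿homo
    ; 0-homo = refl ; 1-homo = +-identityʳ 1# }

  ℤ-equal? : ∀ i j → Maybe (⟦ i ⟧ℤ ≈ ⟦ j ⟧ℤ)
  ℤ-equal? i j with i ℤ.≟ j
  ... | yes P.refl = just refl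
  ... | no _       = nothing

  open import Algebra.Solver.Ring ℤ.+-*-rawRing (ACR.fromCommutativeRing R) ℤ⟶R ℤ-equal? public
    using (Polynomial; con; _:+_; _:*_; :-_; _:-_; _:^_; solve; _:=_)

  -- The constant polynomial with value 1# (con (+ 1) has value 1# + 0#).
  ı : ∀ {n} → Polynomial n
  ı = con (+ 0) :^ 0

  sumP : ∀ {n} → List (Polynomial n) → Polynomial n
  sumP = foldr _:+_ (con (+ 0))

module ListSums {c ℓ} (R : CommutativeRing c ℓ) where
  open CommutativeRing R
  open RingDefs R
  open import Relation.Binary.Reasoning.Setoid setoid

  module _ {a} {A : Set a} where
    sum-++ : ∀ (f : A → Carrier) xs ys →
             sumL (map f (xs ++ ys)) ≈ sumL (map f xs) + sumL (map f ys)
    sum-++ f []       ys = sym (+-identityˡ _)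
    sum-++ f (x ∷ xs) ys = trans (+-congˡ (sum-++ f xs ys)) (sym (+-assoc _ _ _))

    sum-cong : ∀ {f g : A → Carrier} L → (∀ v → f v ≈ g v) →
               sumL (map f L) ≈ sumL (map g L)
    sum-cong []      f≈g = refl
    sum-cong (v ∷ L) f≈g = +-cong (f≈g v) (sum-cong L f≈g)

    sum-zero : ∀ (L : List A) → sumL (map (λ _ → 0#) L) ≈ 0#
    sum-zero []      = refl
    sum-zero (v ∷ L) = trans (+-identityˡ _) (sum-zero L)

    sum-scale : ∀ k (f : A → Carrier) L → sumL (map (λ v → k * f v) L) ≈ k * sumL (map f L)
    sum-scale k f []      = sym (zeroʳ _)
    sum-scale k f (v ∷ L) = trans (+-congˡ (sum-scale k f L)) (sym (distribˡ _ _ _))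

    sum-+ : ∀ (f g : A → Carrier) L →
            sumL (map (λ v → f v + g v) L) ≈ sumL (map f L) + sumL (map g L)
    sum-+ f g []      = sym (+-identityˡ _)
    sum-+ f g (v ∷ L) = begin
      (f v + g v) + sumL (map (λ v → f v + g v) L)       ≈⟨ +-congˡ (sum-+ f g L) ⟩
      (f v + g v) + (sumL (map f L) + sumL (map g L))    ≈⟨ +-assoc _ _ _ ⟩
      f v + (g v + (sumL (map f L) + sumL (map g L)))    ≈⟨ +-congˡ (+-assoc _ _ _) ⟨
      f v + ((g v + sumL (map f L)) + sumL (map g L))    ≈⟨ +-congˡ (+-congʳ (+-comm _ _)) ⟩
      f v + ((sumL (map f L) + g v) + sumL (map g L))    ≈⟨ +-congˡ (+-assoc _ _ _) ⟩
      f v + (sumL (map f L) + (g v + sumL (map g L)))    ≈⟨ +-assoc _ _ _ ⟨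
      (f v + sumL (map f L)) + (g v + sumL (map g L))    ∎

    sum-map : ∀ {b} {B : Set b} (f : A → Carrier) (g : B → A) L →
              sumL (map f (map g L)) ≡ sumL (map (f ∘ g) L)
    sum-map f g L = P.cong sumL (P.sym (LP.map-∘ L))

  sum-swap : ∀ {a b} {A : Set a} {B : Set b} (F : A → B → Carrier) (U : List A) (W : List B) →
    sumL (map (λ u → sumL (map (F u) W)) U) ≈ sumL (map (λ w → sumL (map (λ u → F u w) U)) W)
  sum-swap F []      W = sym (sum-zero W)
  sum-swap F (u ∷ U) W = trans (+-congˡ (sum-swap F U W)) (sym (sum-+ (F u) _ W))

  states-split : ∀ m n (F : Vec Bool (m ℕ.+ n) → Carrier) →
    sumL (map F (allStates (m ℕ.+ n))) ≈
    sumL (map (λ u → sumL (map (λ w → F (u Vec.++ w)) (allStates n))) (allStates m))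
  states-split zero    n F = sym (+-identityʳ _)
  states-split (suc m) n F = begin
    sumL (map F (map (true ∷_) S ++ map (false ∷_) S))
      ≈⟨ sum-++ F (map (true ∷_) S) (map (false ∷_) S) ⟩
    sumL (map F (map (true ∷_) S)) + sumL (map F (map (false ∷_) S))
      ≡⟨ P.cong₂ _+_ (sum-map F _ S) (sum-map F _ S) ⟩
    sumL (map (λ v → F (true ∷ v)) S) + sumL (map (λ v → F (false ∷ v)) S)
      ≈⟨ +-cong (states-split m n (λ v → F (true ∷ v))) (states-split m n (λ v → F (false ∷ v))) ⟩
    sumL (map (λ u → G (true ∷ u)) Sₘ) + sumL (map (λ u → G (false ∷ u)) Sₘ)
      ≡⟨ P.sym (P.cong₂ _+_ (sum-map G _ Sₘ) (sum-map G _ Sₘ)) ⟩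
    sumL (map G (map (true ∷_) Sₘ)) + sumL (map G (map (false ∷_) Sₘ))
      ≈⟨ sum-++ G (map (true ∷_) Sₘ) (map (false ∷_) Sₘ) ⟨
    sumL (map G (map (true ∷_) Sₘ ++ map (false ∷_) Sₘ)) ∎
    where
    S : List (Vec Bool (m ℕ.+ n))
    S = allStates (m ℕ.+ n)
    Sₘ : List (Vec Bool m)
    Sₘ = allStates m
    G : Vec Bool (suc m) → Carrier
    G u = sumL (map (λ w → F (u Vec.++ w)) (allStates n))

smallResolutions : List (ℕ × D3)
smallResolutions =
  (0 , one) ∷ (0 , U₁) ∷ (0 , U₂) ∷ (0 , r) ∷ (0 , s) ∷
  (1 , one) ∷ (1 , U₁) ∷ (1 , U₂) ∷ (1 , r) ∷ (1 , s) ∷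
  (2 , one) ∷ (2 , U₁) ∷ (2 , U₂) ∷ (2 , r) ∷ (2 , s) ∷ []

-- indicator q p is 1 if q = p and 0 otherwise, in the form used by bracketCoeff
indicator : ℕ × D3 → ℕ × D3 → ℕ
indicator q p = if (proj₁ q ≡ᵇ proj₁ p) ∧ eqD3 (proj₂ q) (proj₂ p) then 1 else 0

count : List (ℕ × D3) → ℕ × D3 → ℕ
count L p = foldr ℕ._+_ 0 (map (λ q → indicator q p) L)

bracketCoeff-count : ∀ X k U →
  bracketCoeff X k U ≡ count (map (resolve X) (allStates (crossings X))) (k , U)
bracketCoeff-count X k U = P.cong (foldr ℕ._+_ 0) (LP.map-∘ (allStates (crossings X)))

≡ᵇ-refl : ∀ k → (k ≡ᵇ k) ≡ true
≡ᵇ-refl zero    = P.refl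
≡ᵇ-refl (suc k) = ≡ᵇ-refl k

indicator-self : ∀ q → indicator q q ≡ 1
indicator-self (k , U) rewrite ≡ᵇ-refl k with U
... | one = P.refl
... | U₁  = P.refl
... | U₂  = P.refl
... | r   = P.refl
... | s   = P.refl

eqD3-sound : ∀ a b → T (eqD3 a b) → a ≡ b
eqD3-sound one one _ = P.refl
eqD3-sound U₁  U₁  _ = P.refl
eqD3-sound U₂  U₂  _ = P.refl
eqD3-sound r   r   _ = P.refl
eqD3-sound s   s   _ = P.refl

small-if-no-large : ∀ L → (∀ k U → 3 ℕ.≤ k → count L (k , U) ≡ 0) → All (λ q → proj₁ q ℕ.< 3) L
small-if-no-large []      _       = []
small-if-no-large (q ∷ L) noLarge = head-small ∷ small-if-no-large L noLarge-L
  where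
  noLarge-L : ∀ k U → 3 ℕ.≤ k → count L (k , U) ≡ 0
  noLarge-L k U 3≤k = ℕP.m+n≡0⇒n≡0 (indicator q (k , U)) (noLarge k U 3≤k)
  head-small : proj₁ q ℕ.< 3
  head-small with 3 ℕ.≤? proj₁ q
  ... | no  3≰k = ℕP.≰⇒> 3≰k
  ... | yes 3≤k with P.trans (P.cong (ℕ._+ count L q) (P.sym (indicator-self q)))
                             (noLarge (proj₁ q) (proj₂ q) 3≤k)
  ...   | ()

count-small : ∀ q → proj₁ q ℕ.< 3 → foldr ℕ._+_ 0 (map (indicator q) smallResolutions) ≡ 1
count-small (0 , one) _ = P.refl
count-small (0 , U₁)  _ = P.refl
count-small (0 , U₂)  _ = P.refl
count-small (0 , r)   _ = P.refl
count-small (0 , s)   _ = P.refl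
count-small (1 , one) _ = P.refl
count-small (1 , U₁)  _ = P.refl
count-small (1 , U₂)  _ = P.refl
count-small (1 , r)   _ = P.refl
count-small (1 , s)   _ = P.refl
count-small (2 , one) _ = P.refl
count-small (2 , U₁)  _ = P.refl
count-small (2 , U₂)  _ = P.refl
count-small (2 , r)   _ = P.refl
count-small (2 , s)   _ = P.refl
count-small (suc (suc (suc _)) , _) (ℕ.s≤s (ℕ.s≤s (ℕ.s≤s ())))

-- Sums over the states of a shadow only depend on how often each resolution occurs.
module ResolutionSums {c ℓ} (R : CommutativeRing c ℓ) where
  open CommutativeRing R
  open RingDefs R
  open import Relation.Binary.Reasoning.Setoid setoid
  open IntegerSolver R using (nat-+)
  open ListSums R

  indicator-pick : ∀ (H : ℕ × D3 → Carrier) q p →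
                   nat (indicator q p) * H p ≈ nat (indicator q p) * H q
  indicator-pick H (k , U) (k′ , U′) with k ≡ᵇ k′ in k≡ᵇk′ | eqD3 U U′ in U≡U′
  ... | true  | true
    with ℕP.≡ᵇ⇒≡ k k′ (P.subst T (P.sym k≡ᵇk′) _) | eqD3-sound U U′ (P.subst T (P.sym U≡U′) _)
  ...   | P.refl | P.refl = refl
  indicator-pick H _ _ | true  | false = trans (zeroˡ _) (sym (zeroˡ _))
  indicator-pick H _ _ | false | _     = trans (zeroˡ _) (sym (zeroˡ _))

  sum-nat : ∀ {a} {A : Set a} (f : A → ℕ) (z : Carrier) L →
            sumL (map (λ p → nat (f p) * z) L) ≈ nat (foldr ℕ._+_ 0 (map f L)) * z
  sum-nat f z []      = sym (zeroˡ z)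
  sum-nat f z (p ∷ L) = begin
    nat (f p) * z + sumL (map (λ p → nat (f p) * z) L)   ≈⟨ +-congˡ (sum-nat f z L) ⟩
    nat (f p) * z + nat (foldr ℕ._+_ 0 (map f L)) * z    ≈⟨ distribʳ _ _ _ ⟨
    (nat (f p) + nat (foldr ℕ._+_ 0 (map f L))) * z      ≈⟨ *-congʳ (nat-+ (f p) _) ⟨
    nat (f p ℕ.+ foldr ℕ._+_ 0 (map f L)) * z            ∎

  pick : ∀ (H : ℕ × D3 → Carrier) q → proj₁ q ℕ.< 3 →
         sumL (map (λ p → nat (indicator q p) * H p) smallResolutions) ≈ H q
  pick H q q-small = begin
    sumL (map (λ p → nat (indicator q p) * H p) smallResolutions)
      ≈⟨ sum-cong smallResolutions (indicator-pick H q) ⟩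
    sumL (map (λ p → nat (indicator q p) * H q) smallResolutions)
      ≈⟨ sum-nat (indicator q) (H q) smallResolutions ⟩
    nat (foldr ℕ._+_ 0 (map (indicator q) smallResolutions)) * H q
      ≡⟨ P.cong (λ n → nat n * H q) (count-small q q-small) ⟩
    (1# + 0#) * H q   ≈⟨ *-congʳ (+-identityʳ 1#) ⟩
    1# * H q          ≈⟨ *-identityˡ (H q) ⟩
    H q               ∎

  resolution-sum : ∀ (H : ℕ × D3 → Carrier) L → All (λ q → proj₁ q ℕ.< 3) L →
    sumL (map H L) ≈ sumL (map (λ p → nat (count L p) * H p) smallResolutions)
  resolution-sum H []      []               =
    sym (trans (sum-cong smallResolutions (λ p → zeroˡ (H p))) (sum-zero smallResolutions))
  resolution-sum H (q ∷ L) (q-small ∷ L-small) = begin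
    H q + sumL (map H L)
      ≈⟨ +-cong (sym (pick H q q-small)) (resolution-sum H L L-small) ⟩
    sumL (map (λ p → nat (indicator q p) * H p) smallResolutions)
      + sumL (map (λ p → nat (count L p) * H p) smallResolutions)
      ≈⟨ sum-+ (λ p → nat (indicator q p) * H p) (λ p → nat (count L p) * H p) smallResolutions ⟨
    sumL (map (λ p → nat (indicator q p) * H p + nat (count L p) * H p) smallResolutions)
      ≈⟨ sum-cong smallResolutions (λ p → trans (sym (distribʳ (H p) _ _))
                                               (*-congʳ (sym (nat-+ (indicator q p) (count L p))))) ⟩
    sumL (map (λ p → nat (count (q ∷ L) p) * H p) smallResolutions) ∎

module Transfer {c ℓ} (R : CommutativeRing c ℓ) (x : CommutativeRing.Carrier R) where
  open CommutativeRing R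
  open RingDefs R
  open import Relation.Binary.Reasoning.Setoid setoid
  open IntegerSolver R
  open ListSums R
  open ResolutionSums R

  pow-+ : ∀ a m n → pow a (m ℕ.+ n) ≈ pow a m * pow a n
  pow-+ a zero    n = sym (*-identityˡ _)
  pow-+ a (suc m) n = trans (*-congˡ (pow-+ a m n)) (sym (*-assoc _ _ _))

  Test : Set c
  Test = D3 → Carrier

  weight : Test → ℕ × D3 → Carrier
  weight φ q = pow x (proj₁ q) * φ (proj₂ q)

  stateSum : Test → Shadow → Carrier
  stateSum φ X = sumL (map (λ v → weight φ (resolve X v)) (allStates (crossings X)))

  closing : Test
  closing U = pow x (closureLoops U)

  bracketClosure≈stateSum : ∀ X → bracketClosure x X ≈ stateSum closing X
  bracketClosure≈stateSum X = sum-cong (allStates (crossings X))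
    (λ v → pow-+ x (proj₁ (resolve X v)) (closureLoops (proj₂ (resolve X v))))

  -- the test function seen by Y when the resolution q = ◯ᵏ ⊔ a is stacked on top of it
  stack : ℕ × D3 → Test → Test
  stack q φ b = pow x (proj₁ q) * weight φ (proj₂ q · b)

  take-++ : ∀ {A : Set} {m n} (u : Vec A m) (w : Vec A n) → Vec.take m (u Vec.++ w) ≡ u
  take-++ []      w = P.refl
  take-++ (a ∷ u) w = P.cong (a ∷_) (take-++ u w)

  drop-++ : ∀ {A : Set} {m n} (u : Vec A m) (w : Vec A n) → Vec.drop m (u Vec.++ w) ≡ w
  drop-++ []      w = P.refl
  drop-++ (a ∷ u) w = drop-++ u w

  stateSum-⊗ : ∀ φ X Y → stateSum φ (X ⊗ Y) ≈
    sumL (map (λ u → stateSum (stack (resolve X u) φ) Y) (allStates (crossings X)))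
  stateSum-⊗ φ X Y = trans
    (states-split (crossings X) (crossings Y) (λ v → weight φ (resolve (X ⊗ Y) v)))
    (sum-cong (allStates (crossings X)) λ u → sum-cong (allStates (crossings Y)) λ w →
      trans (reflexive (P.cong₂ stacked (take-++ u w) (drop-++ u w)))
            (regroup (resolve X u) (resolve Y w)))
    where
    stacked : Vec Bool (crossings X) → Vec Bool (crossings Y) → Carrier
    stacked u w = weight φ (proj₁ (resolve X u) ℕ.+ proj₁ (resolve Y w) ℕ.+ proj₁ (proj₂ (resolve X u) · proj₂ (resolve Y w))
                           , proj₂ (proj₂ (resolve X u) · proj₂ (resolve Y w)))
    regroup : ∀ q q′ → weight φ (proj₁ q ℕ.+ proj₁ q′ ℕ.+ proj₁ (proj₂ q · proj₂ q′) , proj₂ (proj₂ q · proj₂ q′))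
                       ≈ weight (stack q φ) q′
    regroup (k , a) (k′ , b) = begin
      pow x (k ℕ.+ k′ ℕ.+ proj₁ (a · b)) * φ (proj₂ (a · b))
        ≈⟨ *-congʳ (trans (pow-+ x (k ℕ.+ k′) _) (*-congʳ (pow-+ x k k′))) ⟩
      pow x k * pow x k′ * pow x (proj₁ (a · b)) * φ (proj₂ (a · b))
        ≈⟨ solve 4 (λ p p′ q f → p :* p′ :* q :* f := p′ :* (p :* (q :* f))) refl
                   (pow x k) (pow x k′) (pow x (proj₁ (a · b))) (φ (proj₂ (a · b))) ⟩
      pow x k′ * (pow x k * (pow x (proj₁ (a · b)) * φ (proj₂ (a · b)))) ∎

  stateSum-linear : ∀ {a} {A : Set a} (w : A → Carrier) (f : A → Test) L Y →
    stateSum (λ b → sumL (map (λ p → w p * f p b) L)) Y ≈ sumL (map (λ p → w p * stateSum (f p) Y) L)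
  stateSum-linear w f L Y = begin
    sumL (map (λ v → pow x (k v) * sumL (map (λ p → w p * f p (U v)) L)) S)
      ≈⟨ sum-cong S (λ v → sym (sum-scale (pow x (k v)) (λ p → w p * f p (U v)) L)) ⟩
    sumL (map (λ v → sumL (map (λ p → pow x (k v) * (w p * f p (U v))) L)) S)
      ≈⟨ sum-swap (λ v p → pow x (k v) * (w p * f p (U v))) S L ⟩
    sumL (map (λ p → sumL (map (λ v → pow x (k v) * (w p * f p (U v))) S)) L)
      ≈⟨ sum-cong L (λ p → trans (sum-cong S (λ v → *-left-swap (pow x (k v)) (w p) (f p (U v))))
                                 (sum-scale (w p) (λ v → weight (f p) (resolve Y v)) S)) ⟩
    sumL (map (λ p → w p * stateSum (f p) Y) L) ∎
    where
    S : List (Vec Bool (crossings Y))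
    S = allStates (crossings Y)
    k : Vec Bool (crossings Y) → ℕ
    k v = proj₁ (resolve Y v)
    U : Vec Bool (crossings Y) → D3
    U v = proj₂ (resolve Y v)
    *-left-swap : ∀ a b d → a * (b * d) ≈ b * (a * d)
    *-left-swap = solve 3 (λ a b d → a :* (b :* d) := b :* (a :* d)) refl

  -- The transfer operator determined by the bracket of E: by the hypothesis on
  -- E, a state of E resolves to ◯ᵏ ⊔ a in exactly coeffE k a ways.
  transfer : Test → Test
  transfer φ b = sumL (map (λ p → nat (coeffE (proj₁ p) (proj₂ p)) * stack p φ b) smallResolutions)

  transfer-step : ∀ (E : Shadow) → (∀ k U → bracketCoeff E k U ≡ coeffE k U) →
                  ∀ φ Y → stateSum φ (E ⊗ Y) ≈ stateSum (transfer φ) Y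
  transfer-step E hyp φ Y = begin
    stateSum φ (E ⊗ Y)
      ≈⟨ stateSum-⊗ φ E Y ⟩
    sumL (map (H ∘ resolve E) S)
      ≡⟨ P.sym (sum-map H (resolve E) S) ⟩
    sumL (map H (map (resolve E) S))
      ≈⟨ resolution-sum H (map (resolve E) S) (small-if-no-large (map (resolve E) S) noLarge) ⟩
    sumL (map (λ p → nat (count (map (resolve E) S) p) * H p) smallResolutions)
      ≡⟨ P.cong sumL (LP.map-cong (λ p → P.cong (λ n → nat n * H p) (coeff≡ p)) smallResolutions) ⟩
    sumL (map (λ p → nat (coeffE (proj₁ p) (proj₂ p)) * H p) smallResolutions)
      ≈⟨ stateSum-linear (λ p → nat (coeffE (proj₁ p) (proj₂ p))) (λ p → stack p φ) smallResolutions Y ⟨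
    stateSum (transfer φ) Y ∎
    where
    S : List (Vec Bool (crossings E))
    S = allStates (crossings E)
    H : ℕ × D3 → Carrier
    H q = stateSum (stack q φ) Y
    coeff≡ : ∀ p → count (map (resolve E) S) p ≡ coeffE (proj₁ p) (proj₂ p)
    coeff≡ (k , U) = P.trans (P.sym (bracketCoeff-count E k U)) (hyp k U)
    noLarge : ∀ k U → 3 ℕ.≤ k → count (map (resolve E) S) (k , U) ≡ 0
    noLarge (suc (suc (suc k))) U (ℕ.s≤s (ℕ.s≤s (ℕ.s≤s _))) = coeff≡ (suc (suc (suc k)) , U)

  transfer^ : ℕ → Test → Test
  transfer^ zero    φ = φ
  transfer^ (suc n) φ = transfer^ n (transfer φ)

  stateSum-power : ∀ (E : Shadow) → (∀ k U → bracketCoeff E k U ≡ coeffE k U) →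
                   ∀ n φ → stateSum φ (E ^^ n) ≈ transfer^ n φ one
  stateSum-power E hyp zero    φ = trans (+-identityʳ _) (*-identityˡ _)
  stateSum-power E hyp (suc n) φ = trans (transfer-step E hyp φ (E ^^ n)) (stateSum-power E hyp n (transfer φ))

  transfer-cong : ∀ {f g} → (∀ b → f b ≈ g b) → ∀ b → transfer f b ≈ transfer g b
  transfer-cong f≈g b = sum-cong smallResolutions λ p →
    *-congˡ {nat (coeffE (proj₁ p) (proj₂ p))} (*-congˡ {pow x (proj₁ p)}
      (*-congˡ {pow x (proj₁ (proj₂ p · b))} (f≈g (proj₂ (proj₂ p · b)))))

  transfer-linear : ∀ a d f g b →
    transfer (λ b → a * f b + d * g b) b ≈ a * transfer f b + d * transfer g b
  transfer-linear a d f g b = begin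
    sumL (map (λ p → C p * stack p (λ b → a * f b + d * g b) b) smallResolutions)
      ≈⟨ sum-cong smallResolutions (λ p → distribute (C p) (pow x (proj₁ p)) (pow x (proj₁ (proj₂ p · b)))
                                                      (f (proj₂ (proj₂ p · b))) (g (proj₂ (proj₂ p · b)))) ⟩
    sumL (map (λ p → a * (C p * stack p f b) + d * (C p * stack p g b)) smallResolutions)
      ≈⟨ sum-+ (λ p → a * (C p * stack p f b)) (λ p → d * (C p * stack p g b)) smallResolutions ⟩
    _ + _
      ≈⟨ +-cong (sum-scale a (λ p → C p * stack p f b) smallResolutions)
                (sum-scale d (λ p → C p * stack p g b) smallResolutions) ⟩
    a * transfer f b + d * transfer g b ∎
    where
    C : ℕ × D3 → Carrier
    C p = nat (coeffE (proj₁ p) (proj₂ p))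
    distribute : ∀ n p q u v → n * (p * (q * (a * u + d * v))) ≈ a * (n * (p * (q * u))) + d * (n * (p * (q * v)))
    distribute n p q u v = solve 7 (λ n p q u v a d → n :* (p :* (q :* (a :* u :+ d :* v)))
                                     := a :* (n :* (p :* (q :* u))) :+ d :* (n :* (p :* (q :* v)))) refl
                                   n p q u v a d

  transfer^-cong : ∀ n {f g} → (∀ b → f b ≈ g b) → ∀ b → transfer^ n f b ≈ transfer^ n g b
  transfer^-cong zero    f≈g = f≈g
  transfer^-cong (suc n) f≈g = transfer^-cong n (transfer-cong f≈g)

  transfer^-linear : ∀ n a d f g b →
    transfer^ n (λ b → a * f b + d * g b) b ≈ a * transfer^ n f b + d * transfer^ n g b
  transfer^-linear zero    a d f g b = refl
  transfer^-linear (suc n) a d f g b =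
    trans (transfer^-cong n (transfer-linear a d f g) b) (transfer^-linear n a d (transfer f) (transfer g) b)

  transfer^-eigen : ∀ μ f → (∀ b → transfer f b ≈ μ * f b) → ∀ n b → transfer^ n f b ≈ pow μ n * f b
  transfer^-eigen μ f eigen zero    b = sym (*-identityˡ _)
  transfer^-eigen μ f eigen (suc n) b = begin
    transfer^ n (transfer f) b                ≈⟨ transfer^-cong n (λ b → trans (eigen b) (padding (f b))) b ⟩
    transfer^ n (λ b → μ * f b + 0# * f b) b  ≈⟨ transfer^-linear n μ 0# f f b ⟩
    μ * transfer^ n f b + 0# * transfer^ n f b  ≈⟨ padding (transfer^ n f b) ⟨
    μ * transfer^ n f b                       ≈⟨ *-congˡ (transfer^-eigen μ f eigen n b) ⟩
    μ * (pow μ n * f b)                       ≈⟨ *-assoc _ _ _ ⟨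
    pow μ (suc n) * f b                       ∎
    where
    padding : ∀ z → μ * z ≈ μ * z + 0# * z
    padding z = sym (trans (+-congˡ (zeroˡ z)) (+-identityʳ _))

  transfer^-quadratic : ∀ a d f → (∀ b → transfer (transfer f) b ≈ a * transfer f b + d * f b) →
    ∀ n b → transfer^ (suc (suc n)) f b ≈ a * transfer^ (suc n) f b + d * transfer^ n f b
  transfer^-quadratic a d f quadratic n b =
    trans (transfer^-cong n quadratic b) (transfer^-linear n a d (transfer f) f b)

module Spectrum {c ℓ} (R : CommutativeRing c ℓ) where
  open CommutativeRing R
  open RingDefs R
  open IntegerSolver R

  -- Polynomial expressions in the variable x which evaluate definitionally to the
  -- corresponding ring expressions, so that identities between the latter can be
  -- handed to the ring solver.
  ΛP τP νP AP : ∀ {m} → Polynomial m → Polynomial m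
  ΛP xp = xp :* xp :+ con (+ 4) :* xp :+ con (+ 4)
  τP xp = con (+ 4) :* (xp :* xp) :+ con (+ 12) :* xp :+ con (+ 9)
  νP xp = con (+ 4) :* xp :^ 4 :+ con (+ 24) :* xp :^ 3 :+ con (+ 52) :* (xp :* xp)
          :+ con (+ 48) :* xp :+ con (+ 16)
  AP xp = xp :* (xp :* xp :- con (+ 2))

  δP : ∀ {m} → D3 → Polynomial m
  δP one = ı
  δP _   = con (+ 0)

  ρP : ∀ {m} → Polynomial m → D3 → Polynomial m
  ρP xp one = con (+ 2)
  ρP xp U₁  = xp
  ρP xp U₂  = xp
  ρP xp r   = ı
  ρP xp s   = ı

  transferP : ∀ {m} → Polynomial m → (D3 → Polynomial m) → D3 → Polynomial m
  transferP xp φ b = sumP (map (λ p → con (+ coeffE (proj₁ p) (proj₂ p))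
                                      :* (xp :^ proj₁ p :* (xp :^ proj₁ (proj₂ p · b) :* φ (proj₂ (proj₂ p · b)))))
                               smallResolutions)

  module _ (x : Carrier) where
    open Transfer R x

    -- eigenvalue (x+2)², and trace and norm of the quadratic factor
    Λ τ ν A₀ : Carrier
    Λ  = x * x + nat 4 * x + nat 4
    τ  = nat 4 * (x * x) + nat 12 * x + nat 9
    ν  = nat 4 * pow x 4 + nat 24 * pow x 3 + nat 52 * (x * x) + nat 48 * x + nat 16
    A₀ = x * (x * x - nat 2)

    δ ρ : Test
    δ one = 1#
    δ _   = 0#
    ρ one = nat 2
    ρ U₁  = x
    ρ U₂  = x
    ρ r   = 1#
    ρ s   = 1#

    closing-split : ∀ b → closing b ≈ A₀ * δ b + x * ρ b
    closing-split one = solve 1 (λ xp → xp :^ 3 := AP xp :* δP one :+ xp :* ρP xp one) refl x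
    closing-split U₁  = solve 1 (λ xp → xp :^ 2 := AP xp :* δP U₁  :+ xp :* ρP xp U₁)  refl x
    closing-split U₂  = solve 1 (λ xp → xp :^ 2 := AP xp :* δP U₂  :+ xp :* ρP xp U₂)  refl x
    closing-split r   = solve 1 (λ xp → xp :^ 1 := AP xp :* δP r   :+ xp :* ρP xp r)   refl x
    closing-split s   = solve 1 (λ xp → xp :^ 1 := AP xp :* δP s   :+ xp :* ρP xp s)   refl x

    δ-eigen : ∀ b → transfer δ b ≈ Λ * δ b
    δ-eigen one = solve 1 (λ xp → transferP xp δP one := ΛP xp :* δP one) refl x
    δ-eigen U₁  = solve 1 (λ xp → transferP xp δP U₁  := ΛP xp :* δP U₁)  refl x
    δ-eigen U₂  = solve 1 (λ xp → transferP xp δP U₂  := ΛP xp :* δP U₂)  refl x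
    δ-eigen r   = solve 1 (λ xp → transferP xp δP r   := ΛP xp :* δP r)   refl x
    δ-eigen s   = solve 1 (λ xp → transferP xp δP s   := ΛP xp :* δP s)   refl x

    ρ-quadratic : ∀ b → transfer (transfer ρ) b ≈ τ * transfer ρ b + (- ν) * ρ b
    ρ-quadratic one = solve 1 (λ xp → transferP xp (transferP xp (ρP xp)) one
                                      := τP xp :* transferP xp (ρP xp) one :+ (:- νP xp) :* ρP xp one) refl x
    ρ-quadratic U₁  = solve 1 (λ xp → transferP xp (transferP xp (ρP xp)) U₁
                                      := τP xp :* transferP xp (ρP xp) U₁ :+ (:- νP xp) :* ρP xp U₁) refl x
    ρ-quadratic U₂  = solve 1 (λ xp → transferP xp (transferP xp (ρP xp)) U₂
                                      := τP xp :* transferP xp (ρP xp) U₂ :+ (:- νP xp) :* ρP xp U₂) refl x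
    ρ-quadratic r   = solve 1 (λ xp → transferP xp (transferP xp (ρP xp)) r
                                      := τP xp :* transferP xp (ρP xp) r :+ (:- νP xp) :* ρP xp r) refl x
    ρ-quadratic s   = solve 1 (λ xp → transferP xp (transferP xp (ρP xp)) s
                                      := τP xp :* transferP xp (ρP xp) s :+ (:- νP xp) :* ρP xp s) refl x

    transfer-ρ-one : transfer ρ one ≈ τ
    transfer-ρ-one = solve 1 (λ xp → transferP xp (ρP xp) one := τP xp) refl x

module Recurrences {c ℓ} (R : CommutativeRing c ℓ) where
  open CommutativeRing R
  open RingDefs R
  open import Relation.Binary.Reasoning.Setoid setoid
  open IntegerSolver R

  Satisfies : Carrier → Carrier → (ℕ → Carrier) → Set ℓ
  Satisfies a d u = ∀ n → u (suc (suc n)) ≈ a * u (suc n) + d * u n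

  recurrence-unique : ∀ {a d u v} → Satisfies a d u → Satisfies a d v →
                      u 0 ≈ v 0 → u 1 ≈ v 1 → ∀ n → u n ≈ v n
  recurrence-unique {a} {d} {u} {v} rec-u rec-v u₀ u₁ n = proj₁ (agree n)
    where
    agree : ∀ n → u n ≈ v n × u (suc n) ≈ v (suc n)
    agree zero    = u₀ , u₁
    agree (suc n) = proj₂ (agree n) ,
      trans (rec-u n) (trans (+-cong (*-congˡ (proj₂ (agree n))) (*-congˡ (proj₁ (agree n)))) (sym (rec-v n)))

  lucas : Carrier → Carrier → ℕ → Carrier
  lucas a d zero          = nat 2
  lucas a d (suc zero)    = a
  lucas a d (suc (suc n)) = a * lucas a d (suc n) + d * lucas a d n

  lucas-satisfies : ∀ a d → Satisfies a d (lucas a d)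
  lucas-satisfies a d n = refl

  power-sums : ∀ α β → Satisfies (α + β) (- (α * β)) (λ n → pow α n + pow β n)
  power-sums α β n = solve 4 (λ α β αⁿ βⁿ → α :* (α :* αⁿ) :+ β :* (β :* βⁿ)
                                := (α :+ β) :* (α :* αⁿ :+ β :* βⁿ) :+ (:- (α :* β)) :* (αⁿ :+ βⁿ))
                             refl α β (pow α n) (pow β n)

  lucas-closed-form : ∀ {a d} α β → α + β ≈ a → - (α * β) ≈ d →
                      ∀ n → pow α n + pow β n ≈ lucas a d n
  lucas-closed-form {a} {d} α β sum prod = recurrence-unique
    (λ n → trans (power-sums α β n) (+-cong (*-congʳ sum) (*-congʳ prod)))
    (lucas-satisfies a d)
    (+-congˡ (sym (+-identityʳ 1#)))
    (trans (+-cong (*-identityʳ α) (*-identityʳ β)) sum)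

module PowerSeries {c ℓ} (R : CommutativeRing c ℓ) where
  open CommutativeRing R
  open RingDefs R
  open import Relation.Binary.Reasoning.Setoid setoid
  open ListSums R

  ⋆-congˡ : ∀ {f f′} g → (∀ i → f i ≈ f′ i) → ∀ n → (f ⋆ g) n ≈ (f′ ⋆ g) n
  ⋆-congˡ g f≈f′ n = sum-cong (upTo (suc n)) (λ i → *-congʳ (f≈f′ i))

  ⋆-congʳ : ∀ f {g g′} → (∀ i → g i ≈ g′ i) → ∀ n → (f ⋆ g) n ≈ (f ⋆ g′) n
  ⋆-congʳ f g≈g′ n = sum-cong (upTo (suc n)) (λ i → *-congˡ (g≈g′ (n ∸ i)))

  sum-applyUpTo : ∀ m (f : ℕ → ℕ) (h : ℕ → Carrier) →
                  sumL (map h (applyUpTo f m)) ≈ sumL (map (h ∘ f) (upTo m))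
  sum-applyUpTo zero    f h = refl
  sum-applyUpTo (suc m) f h = +-congˡ (trans (sum-applyUpTo m (f ∘ suc) h)
                                             (sym (sum-applyUpTo m suc (h ∘ f))))

  ⋆-suc : ∀ f g n → (f ⋆ g) (suc n) ≈ f 0 * g (suc n) + ((f ∘ suc) ⋆ g) n
  ⋆-suc f g n = +-congˡ (sum-applyUpTo (suc n) suc (λ i → f i * g (suc n ∸ i)))

  ⋆-zero : ∀ f g → (f ⋆ g) 0 ≈ f 0 * g 0
  ⋆-zero f g = +-identityʳ _

  poly[]-⋆ : ∀ g n → (poly [] ⋆ g) n ≈ 0#
  poly[]-⋆ g n = trans (sum-cong (upTo (suc n)) (λ i → zeroˡ (g (n ∸ i)))) (sum-zero (upTo (suc n)))

  Vanishes : ℕ → Series → Set ℓ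
  Vanishes m f = ∀ n → m ℕ.≤ n → f n ≈ 0#

  poly-vanishes : ∀ cs → Vanishes (length cs) (poly cs)
  poly-vanishes []       n       _         = refl
  poly-vanishes (c ∷ cs) (suc n) (ℕ.s≤s m≤n) = poly-vanishes cs n m≤n

  ⋆-vanishes : ∀ c cs {m g} → Vanishes m g → Vanishes (length cs ℕ.+ m) (poly (c ∷ cs) ⋆ g)
  ⋆-vanishes c []        {g = g} g-van zero    m≤0 =
    trans (⋆-zero (poly (c ∷ [])) g) (trans (*-congˡ (g-van 0 m≤0)) (zeroʳ c))
  ⋆-vanishes c []        {g = g} g-van (suc n) m≤n = begin
    (poly (c ∷ []) ⋆ g) (suc n)       ≈⟨ ⋆-suc (poly (c ∷ [])) g n ⟩
    c * g (suc n) + (poly [] ⋆ g) n   ≈⟨ +-cong (*-congˡ (g-van (suc n) m≤n)) (poly[]-⋆ g n) ⟩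
    c * 0# + 0#                       ≈⟨ +-identityʳ _ ⟩
    c * 0#                            ≈⟨ zeroʳ c ⟩
    0#                                ∎
  ⋆-vanishes c (c′ ∷ cs) {m} {g} g-van (suc n) (ℕ.s≤s l≤n) = begin
    (poly (c ∷ c′ ∷ cs) ⋆ g) (suc n)         ≈⟨ ⋆-suc (poly (c ∷ c′ ∷ cs)) g n ⟩
    c * g (suc n) + (poly (c′ ∷ cs) ⋆ g) n   ≈⟨ +-cong (*-congˡ (g-van (suc n) m≤1+n))
                                                       (⋆-vanishes c′ cs g-van n l≤n) ⟩
    c * 0# + 0#                              ≈⟨ +-identityʳ _ ⟩
    c * 0#                                   ≈⟨ zeroʳ c ⟩
    0#                                       ∎
    where
    m≤1+n : m ℕ.≤ suc n
    m≤1+n = ℕP.m+n≤o⇒n≤o (suc (length cs)) (ℕ.s≤s l≤n)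

  truncation : ∀ m f → Vanishes m f → ∀ n → f n ≈ poly (applyUpTo f m) n
  truncation zero    f f-van n       = f-van n ℕ.z≤n
  truncation (suc m) f f-van zero    = refl
  truncation (suc m) f f-van (suc n) =
    truncation m (f ∘ suc) (λ n m≤n → f-van (suc n) (ℕ.s≤s m≤n)) n

  ⋆-constant : ∀ c g n → (poly (c ∷ []) ⋆ g) n ≈ c * g n
  ⋆-constant c g zero    = ⋆-zero (poly (c ∷ [])) g
  ⋆-constant c g (suc n) = trans (⋆-suc (poly (c ∷ [])) g n) (trans (+-congˡ (poly[]-⋆ g n)) (+-identityʳ _))

  ⋆-cubic : ∀ q₀ q₁ q₂ q₃ g k → (poly (q₀ ∷ q₁ ∷ q₂ ∷ q₃ ∷ []) ⋆ g) (3 ℕ.+ k) ≈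
            q₀ * g (3 ℕ.+ k) + (q₁ * g (2 ℕ.+ k) + (q₂ * g (1 ℕ.+ k) + q₃ * g k))
  ⋆-cubic q₀ q₁ q₂ q₃ g k =
    trans (⋆-suc (poly (q₀ ∷ q₁ ∷ q₂ ∷ q₃ ∷ [])) g (2 ℕ.+ k)) (+-congˡ (
    trans (⋆-suc (poly (q₁ ∷ q₂ ∷ q₃ ∷ [])) g (1 ℕ.+ k)) (+-congˡ (
    trans (⋆-suc (poly (q₂ ∷ q₃ ∷ [])) g k) (+-congˡ (⋆-constant q₃ g k))))))

-- A rational generating function: the sequence A₀ Λⁿ + x Lₙ, with L the Lucas
-- sequence of z² - τ z + ν, has generating function
--   N₁ / Q₁ + N₂ / Q₂,  Q₁ = 1 - τ y + ν y²,  Q₂ = 1 - Λ y,  N₁ = x (2 - τ y),  N₂ = A₀,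
-- stated without division as  Q₁ Q₂ F = N₁ Q₂ + N₂ Q₁.
module RationalGeneratingFunction {c ℓ} (R : CommutativeRing c ℓ) where
  open CommutativeRing R
  open RingDefs R
  open import Relation.Binary.Reasoning.Setoid setoid
  open IntegerSolver R
  open Recurrences R
  open PowerSeries R

  -- polynomial expressions mirroring poly, _⋆_ and lucas, for the ring solver
  polyP : ∀ {m} → List (Polynomial m) → ℕ → Polynomial m
  polyP []       _       = con (+ 0)
  polyP (a ∷ as) zero    = a
  polyP (a ∷ as) (suc i) = polyP as i

  convP : ∀ {m} → (ℕ → Polynomial m) → (ℕ → Polynomial m) → ℕ → Polynomial m
  convP f g n = sumP (map (λ i → f i :* g (n ∸ i)) (upTo (suc n)))

  lucasP : ∀ {m} → Polynomial m → Polynomial m → ℕ → Polynomial m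
  lucasP a d zero          = con (+ 2)
  lucasP a d (suc zero)    = a
  lucasP a d (suc (suc n)) = a :* lucasP a d (suc n) :+ d :* lucasP a d n

  module _ (x τ ν Λ A₀ : Carrier) where
    Q₁ Q₂ N₁ N₂ F : Series
    Q₁ = poly (1# ∷ - τ ∷ ν ∷ [])
    Q₂ = poly (1# ∷ - Λ ∷ [])
    N₁ = poly (x * nat 2 ∷ x * (- τ) ∷ [])
    N₂ = poly (A₀ ∷ [])
    F n = A₀ * pow Λ n + x * lucas τ (- ν) n

    module _ {m} (xp τp νp Λp Ap : Polynomial m) where
      Q₁P Q₂P N₁P N₂P FP lhsP rhsP : ℕ → Polynomial m
      Q₁P = polyP (ı ∷ :- τp ∷ νp ∷ [])
      Q₂P = polyP (ı ∷ :- Λp ∷ [])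
      N₁P = polyP (xp :* con (+ 2) ∷ xp :* (:- τp) ∷ [])
      N₂P = polyP (Ap ∷ [])
      FP n = Ap :* Λp :^ n :+ xp :* lucasP τp (:- νp) n
      lhsP = convP (convP Q₁P Q₂P) FP
      rhsP n = convP N₁P Q₂P n :+ convP N₂P Q₁P n

    -- Q₁ Q₂ is the characteristic polynomial of the order-three recurrence satisfied by F
    annihilated : ∀ k → (Q₁ ⋆ Q₂) 0 * F (3 ℕ.+ k) + ((Q₁ ⋆ Q₂) 1 * F (2 ℕ.+ k)
                        + ((Q₁ ⋆ Q₂) 2 * F (1 ℕ.+ k) + (Q₁ ⋆ Q₂) 3 * F k)) ≈ 0#
    annihilated k = solve 8
      (λ xp τp νp Λp Ap Λᵏ L₁ L₀ →
        let QQ = convP (Q₁P xp τp νp Λp Ap) (Q₂P xp τp νp Λp Ap) in QQ 0 :* (Ap :* (Λp :* (Λp :* (Λp :* Λᵏ)))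
                    :+ xp :* (τp :* (τp :* L₁ :+ (:- νp) :* L₀) :+ (:- νp) :* L₁))
           :+ (QQ 1 :* (Ap :* (Λp :* (Λp :* Λᵏ)) :+ xp :* (τp :* L₁ :+ (:- νp) :* L₀))
           :+ (QQ 2 :* (Ap :* (Λp :* Λᵏ) :+ xp :* L₁) :+ QQ 3 :* (Ap :* Λᵏ :+ xp :* L₀)))
        := con (+ 0))
      refl x τ ν Λ A₀ (pow Λ k) (lucas τ (- ν) (suc k)) (lucas τ (- ν) k)

    rational : ∀ n → ((Q₁ ⋆ Q₂) ⋆ F) n ≈ ((N₁ ⋆ Q₂) ⊕ (N₂ ⋆ Q₁)) n
    rational 0 = solve 5 (λ xp τp νp Λp Ap → lhsP xp τp νp Λp Ap 0 := rhsP xp τp νp Λp Ap 0) refl x τ ν Λ A₀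
    rational 1 = solve 5 (λ xp τp νp Λp Ap → lhsP xp τp νp Λp Ap 1 := rhsP xp τp νp Λp Ap 1) refl x τ ν Λ A₀
    rational 2 = solve 5 (λ xp τp νp Λp Ap → lhsP xp τp νp Λp Ap 2 := rhsP xp τp νp Λp Ap 2) refl x τ ν Λ A₀
    rational (suc (suc (suc k))) = begin
      ((Q₁ ⋆ Q₂) ⋆ F) (3 ℕ.+ k)
        ≈⟨ ⋆-congˡ F (truncation 4 (Q₁ ⋆ Q₂) (⋆-vanishes 1# (- τ ∷ ν ∷ []) (poly-vanishes (1# ∷ - Λ ∷ [])))) (3 ℕ.+ k) ⟩
      (poly (applyUpTo (Q₁ ⋆ Q₂) 4) ⋆ F) (3 ℕ.+ k)
        ≈⟨ ⋆-cubic _ _ _ _ F k ⟩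
      _ ≈⟨ annihilated k ⟩
      0#
        ≈⟨ +-identityʳ 0# ⟨
      0# + 0#
        ≈⟨ +-cong (⋆-vanishes (x * nat 2) (x * (- τ) ∷ []) (poly-vanishes (1# ∷ - Λ ∷ [])) (3 ℕ.+ k) 3≤3+k)
                  (⋆-vanishes A₀ [] (poly-vanishes (1# ∷ - τ ∷ ν ∷ [])) (3 ℕ.+ k) 3≤3+k) ⟨
      ((N₁ ⋆ Q₂) ⊕ (N₂ ⋆ Q₁)) (3 ℕ.+ k) ∎
      where
      3≤3+k : 3 ℕ.≤ 3 ℕ.+ k
      3≤3+k = ℕP.m≤m+n 3 k

module ClosureOfPowers {c ℓ} (R : CommutativeRing c ℓ) where
  open CommutativeRing R
  open RingDefs R
  open import Relation.Binary.Reasoning.Setoid setoid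
  open IntegerSolver R
  open Recurrences R
  open Spectrum R

  bracket-formula : ∀ (E : Shadow) → (∀ k U → bracketCoeff E k U ≡ coeffE k U) →
    ∀ x n → bracketClosure x (E ^^ n) ≈ A₀ x * pow (Λ x) n + x * lucas (τ x) (- ν x) n
  bracket-formula E hyp x n = begin
    bracketClosure x (E ^^ n)                         ≈⟨ bracketClosure≈stateSum (E ^^ n) ⟩
    stateSum closing (E ^^ n)                         ≈⟨ stateSum-power E hyp n closing ⟩
    transfer^ n closing one                           ≈⟨ transfer^-cong n (closing-split x) one ⟩
    transfer^ n (λ b → A₀ x * δ x b + x * ρ x b) one  ≈⟨ transfer^-linear n (A₀ x) x (δ x) (ρ x) one ⟩
    A₀ x * transfer^ n (δ x) one + x * transfer^ n (ρ x) one
      ≈⟨ +-cong (*-congˡ (trans (transfer^-eigen (Λ x) (δ x) (δ-eigen x) n one) (*-identityʳ _)))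
                (*-congˡ (recurrence-unique (λ n → transfer^-quadratic (τ x) (- ν x) (ρ x) (ρ-quadratic x) n one)
                                            (lucas-satisfies (τ x) (- ν x)) refl (transfer-ρ-one x) n)) ⟩
    A₀ x * pow (Λ x) n + x * lucas (τ x) (- ν x) n    ∎
    where open Transfer R x

  -- the roots (τ ∓ d)/2 of z² - τ z + ν, where d² = τ² - 4ν = 8x² + 24x + 17
  module Roots (x d h : Carrier) (d² : d * d ≈ nat 8 * (x * x) + nat 24 * x + nat 17)
               (2h≈1 : nat 2 * h ≈ 1#) where
    α β : Carrier
    α = (τ x - d) * h
    β = (τ x + d) * h

    α+β≈τ : α + β ≈ τ x
    α+β≈τ = begin
      (τ x - d) * h + (τ x + d) * h   ≈⟨ solve 3 (λ t d h → (t :- d) :* h :+ (t :+ d) :* h := t :* (con (+ 2) :* h))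
                                               refl (τ x) d h ⟩
      τ x * (nat 2 * h)               ≈⟨ *-congˡ 2h≈1 ⟩
      τ x * 1#                        ≈⟨ *-identityʳ _ ⟩
      τ x                             ∎

    -αβ≈-ν : - (α * β) ≈ - ν x
    -αβ≈-ν = -‿cong (begin
      ((τ x - d) * h) * ((τ x + d) * h)
        ≈⟨ solve 3 (λ t d h → ((t :- d) :* h) :* ((t :+ d) :* h) := (t :* t :- d :* d) :* (h :* h)) refl (τ x) d h ⟩
      (τ x * τ x - d * d) * (h * h)
        ≈⟨ *-congʳ (+-congˡ (-‿cong d²)) ⟩
      (τ x * τ x - (nat 8 * (x * x) + nat 24 * x + nat 17)) * (h * h)
        ≈⟨ solve 2 (λ xp h → (τP xp :* τP xp :- (con (+ 8) :* (xp :* xp) :+ con (+ 24) :* xp :+ con (+ 17))) :* (h :* h)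
                             := νP xp :* ((con (+ 2) :* h) :* (con (+ 2) :* h))) refl x h ⟩
      ν x * ((nat 2 * h) * (nat 2 * h))
        ≈⟨ *-congˡ (trans (*-cong 2h≈1 2h≈1) (*-identityʳ 1#)) ⟩
      ν x * 1#
        ≈⟨ *-identityʳ _ ⟩
      ν x ∎)

mainTheorem7 : ∀ {c ℓ} (E : Shadow) →
  (∀ (k : ℕ) (U : D3) → bracketCoeff E k U ≡ coeffE k U) →
  ((R : CommutativeRing c ℓ) →
    let open CommutativeRing R
        open RingDefs R
    in ∀ (x d h : Carrier) →
       d * d ≈ nat 8 * (x * x) + nat 24 * x + nat 17 →
       nat 2 * h ≈ 1# →
       ∀ (n : ℕ) →
       bracketClosure x (E ^^ n) ≈
         x * (x * x - nat 2) * pow (x * x + nat 4 * x + nat 4) n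
         + x * (pow ((nat 4 * (x * x) + nat 12 * x + nat 9 - d) * h) n
                + pow ((nat 4 * (x * x) + nat 12 * x + nat 9 + d) * h) n))
  ×
  ((R : CommutativeRing c ℓ) →
    let open CommutativeRing R
        open RingDefs R
    in ∀ (x : Carrier) →
       let T  = nat 4 * (x * x) + nat 12 * x + nat 9
           P  = nat 4 * pow x 4 + nat 24 * pow x 3 + nat 52 * (x * x) + nat 48 * x + nat 16
           Q₁ = poly (1# ∷ - T ∷ P ∷ [])
           Q₂ = poly (1# ∷ - (x * x + nat 4 * x + nat 4) ∷ [])
           N₁ = poly (x * nat 2 ∷ x * (- T) ∷ [])
           N₂ = poly (x * (x * x - nat 2) ∷ [])
           F  = λ (n : ℕ) → bracketClosure x (E ^^ n)
       in ∀ (n : ℕ) → ((Q₁ ⋆ Q₂) ⋆ F) n ≈ ((N₁ ⋆ Q₂) ⊕ (N₂ ⋆ Q₁)) n)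
mainTheorem7 E hyp =
  (λ R x d h d² 2h≈1 n →
    let open CommutativeRing R
        open ClosureOfPowers R
        open Recurrences R
        open Roots x d h d² 2h≈1
    in trans (bracket-formula E hyp x n) (+-congˡ (*-congˡ (sym (lucas-closed-form α β α+β≈τ -αβ≈-ν n)))))
  ,
  (λ R x n →
    let open CommutativeRing R
        open RingDefs R
        open ClosureOfPowers R
        open Spectrum R
        open PowerSeries R
        open RationalGeneratingFunction R
    in trans (⋆-congʳ (Q₁ x (τ x) (ν x) (Λ x) (A₀ x) ⋆ Q₂ x (τ x) (ν x) (Λ x) (A₀ x)) (bracket-formula E hyp x) n)
             (rational x (τ x) (ν x) (Λ x) (A₀ x) n))
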